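{- Let $G=(V,E)$ be an infinite, connected, vertex-transitive, simple graph with finite vertex-degree, let $\mathcal A\subseteq\mathrm{Aut}(G)$ act transitively on $V$, and let $\mathcal A_0$ be a normal subgroup of $\mathcal A$. (a) If $\mathcal A_0$ is unimodular, then $\mathcal A_0$ is symmetric, i.e. $|\partial v\cap\bar w|=|\partial w\cap\bar v|$ for all $v,w\in V$. (b) If $\mathcal A_0$ has type 3, then $|\partial v\cap\bar v|=0$ for all $v\in V$, and $|\partial v\cap\bar w|=|\partial w\cap\bar v|=1$ whenever $\bar v\ne\bar w$ and $|\partial v\cap\bar w|\ge1$; in particular $\mathcal A_0$ is symmetric.
   Context: For $x\in V$, $\bar x=\mathcal A_0x$ denotes the orbit of $x$ under $\mathcal A_0$ and $\partial x$ the set of neighbours of $x$ in $G$; $d_G$ is graph distance. Let $\mathrm{Stab}^0_u=\{\alpha\in\mathcal A_0:\alpha u=u\}$ and $\mathrm{Stab}^0_u v=\{\alpha v:\alpha\in\mathrm{Stab}^0_u\}$. $\mathcal A_0$ is called unimodular if $|\mathrm{Stab}^0_u v|=|\mathrm{Stab}^0_v u|$ for all $u,v\in V$. Type: for $v\in V$ let $d=\min\{d_G(v,w): w\ne v,\ \bar w=\bar v\}$ (this does not depend on $v$); $\mathcal A_0$ has type 1 if $d=1$, type 2 if $d=2$, type 3 if $d\ge3$. -}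

module Defs where

open import Data.Nat using (ℕ; _<_)
open import Data.List using (List; length)
open import Data.List.Membership.Propositional using (_∈_)
open import Data.List.Relation.Unary.Unique.Propositional using (Unique)
open import Data.Product using (Σ; ∃; _×_; _,_)
open import Function.Bundles using (_⇔_)
open import Relation.Binary.PropositionalEquality using (_≡_; _≢_)
open import Relation.Nullary using (¬_)

HasCard : {V : Set} → (V → Set) → ℕ → Set
HasCard {V} P n =
  Σ (List V) λ xs → Unique xs × length xs ≡ n × (∀ x → (x ∈ xs) ⇔ P x)

-- |P| = |Q| (the sets in question are finite in our setting)
SameCard : {V : Set} → (V → Set) → (V → Set) → Set
SameCard P Q = ∀ m n → HasCard P m → HasCard Q n → m ≡ n

IsSimple : {V : Set} → (V → V → Set) → Set
IsSimple {V} E = (∀ x y → E x y → E y x) × (∀ x → ¬ E x x)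

InfiniteType : Set → Set
InfiniteType V = ¬ (Σ (List V) λ xs → ∀ x → x ∈ xs)

data Walk {V : Set} (E : V → V → Set) : ℕ → V → V → Set where
  here  : ∀ {x} → Walk E 0 x x
  step  : ∀ {k x y z} → E x y → Walk E k y z → Walk E (ℕ.suc k) x z

Connected : {V : Set} → (V → V → Set) → Set
Connected {V} E = ∀ x y → ∃ λ k → Walk E k x y

LocallyFinite : {V : Set} → (V → V → Set) → Set
LocallyFinite {V} E = ∀ v → ∃ λ n → HasCard (E v) n

DistGE : {V : Set} → (V → V → Set) → V → V → ℕ → Set
DistGE E v w k = ∀ n → n < k → ¬ Walk E n v w

record Aut {V : Set} (E : V → V → Set) : Set where
  field
    fun     : V → V
    inv     : V → V
    inv-l   : ∀ x → inv (fun x) ≡ x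
    inv-r   : ∀ x → fun (inv x) ≡ x
    pres    : ∀ x y → E x y ⇔ E (fun x) (fun y)
open Aut public

module _ {V : Set} {E : V → V → Set} where

  record IsSubgroup (S : Aut E → Set) : Set where
    field
      resp   : ∀ α β → (∀ x → fun α x ≡ fun β x) → S α → S β
      has-id : ∀ α → (∀ x → fun α x ≡ x) → S α
      comp   : ∀ α β γ → (∀ x → fun γ x ≡ fun α (fun β x)) → S α → S β → S γ
      inverse : ∀ α β → (∀ x → fun β x ≡ inv α x) → S α → S β

  Subset : (Aut E → Set) → (Aut E → Set) → Set
  Subset S T = ∀ α → S α → T α

  IsNormalIn : (Aut E → Set) → (Aut E → Set) → Set
  IsNormalIn S T = ∀ α β γ → T α → S β →
    (∀ x → fun γ x ≡ fun α (fun β (inv α x))) → S γ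

  Transitive : (Aut E → Set) → Set
  Transitive S = ∀ u v → Σ (Aut E) λ α → S α × fun α u ≡ v

  InOrbit : (Aut E → Set) → V → V → Set
  InOrbit S u x = Σ (Aut E) λ α → S α × fun α u ≡ x

  SameOrbit : (Aut E → Set) → V → V → Set
  SameOrbit S u w = ∀ x → InOrbit S u x ⇔ InOrbit S w x

  InStabOrb : (Aut E → Set) → V → V → V → Set
  InStabOrb S u v x = Σ (Aut E) λ α → S α × fun α u ≡ u × fun α v ≡ x

  Unimodular : (Aut E → Set) → Set
  Unimodular S = ∀ u v → SameCard (InStabOrb S u v) (InStabOrb S v u)

  NbrIn : (Aut E → Set) → V → V → V → Set
  NbrIn S v w x = E v x × InOrbit S w x

  Symmetric : (Aut E → Set) → Set
  Symmetric S = ∀ v w → SameCard (NbrIn S v w) (NbrIn S w v)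

  Type3 : (Aut E → Set) → Set
  Type3 S = ∀ v w → w ≢ v → SameOrbit S w v → DistGE E v w 3

-- Part (a) is a double count. For v, w put X = ∂v ∩ w̄ and Y = ∂w ∩ v̄ and join x ∈ X to
-- y ∈ Y when some α ∈ 𝒜₀ carries the edge (v, x) to (y, w). If x and y are joined, the
-- degree of x is |Stab⁰_w y| and that of y is |Stab⁰_v x|; conjugating by α identifies the
-- latter with |Stab⁰_y w|, so by unimodularity joined vertices have equal degree. A bipartite
-- graph without isolated vertices whose edges join vertices of equal degree has sides of equal
-- size, since for every k both sides have the same number of vertices of degree k. As being
-- joined need not be decidable, the count is carried out under a double negation, which is
-- harmless for an equation between natural numbers.
-- Part (b): in type 3 two neighbours of v in one orbit are at distance at most 2, hence equal,
-- and ∂v ∩ v̄ is empty because its elements are at distance 1 from v.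
module Submission where

open import Defs
open import Data.Nat.Base using (ℕ; zero; suc; _+_; _*_; _≤_; _<_; z≤n; s≤s)
open import Data.Nat.Properties
open import Algebra.Properties.Semiring.Sum +-*-semiring
  using (sum-syntax; ∑-comm; sum-cong-≗; *-distribˡ-sum; *-distribʳ-sum; sum-replicate-zero)
open import Data.Bool.Base using (Bool; true; false)
open import Data.Empty using (⊥-elim)
open import Data.Fin.Base using (Fin; zero; suc; toℕ)
open import Data.List.Base using (List; []; _∷_; length; lookup; map; filter; tabulate; allFin)
open import Data.List.Membership.Propositional using (_∈_)
open import Data.List.Membership.Propositional.Properties
  using (∈-map⁺; ∈-map⁻; ∈-filter⁺; ∈-filter⁻; ∈-allFin; ∈-lookup)
open import Data.List.Properties using (length-map)
open import Data.List.Relation.Unary.All as All using ()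
open import Data.List.Relation.Unary.AllPairs using ([]; _∷_)
open import Data.List.Relation.Unary.Any using (here; there; index)
open import Data.List.Relation.Unary.Any.Properties using (lookup-index)
open import Data.List.Relation.Unary.Unique.Propositional using (Unique)
import Data.List.Relation.Unary.Unique.Propositional.Properties as Unique
open import Data.Product using (Σ; ∃; _×_; _,_; proj₁; proj₂)
open import Data.Sum using (_⊎_; inj₁; inj₂)
open import Function.Base using (_∘_; case_of_)
open import Function.Bundles using (_⇔_; mk⇔; Equivalence)
open import Relation.Binary.PropositionalEquality
open import Relation.Nullary using (¬_; Dec; yes; no; ⌊_⌋)
open import Relation.Nullary.Decidable using (decidable-stable; ¬¬-excluded-middle)
open import Relation.Nullary.Negation using (¬¬-map)
open import Relation.Unary using (Decidable)

open Equivalence using (to; from)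
open ≡-Reasoning

𝟙 : Bool → ℕ
𝟙 true  = 1
𝟙 false = 0

δ : ℕ → ℕ → ℕ
δ zero    zero    = 1
δ zero    (suc _) = 0
δ (suc _) zero    = 0
δ (suc k) (suc x) = δ k x

δ-*-comm : ∀ k x → δ k x * x ≡ δ k x * k
δ-*-comm zero    zero    = refl
δ-*-comm zero    (suc x) = refl
δ-*-comm (suc k) zero    = refl
δ-*-comm (suc k) (suc x) = begin
  δ k x * suc x     ≡⟨ *-suc (δ k x) x ⟩
  δ k x + δ k x * x ≡⟨ cong (δ k x +_) (δ-*-comm k x) ⟩
  δ k x + δ k x * k ≡⟨ *-suc (δ k x) k ⟨
  δ k x * suc k     ∎

∑-δ : ∀ N x → x < N → ∑[ k < N ] δ (toℕ k) x ≡ 1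
∑-δ (suc N) zero    _         = cong suc (sum-replicate-zero N)
∑-δ (suc N) (suc x) (s≤s x<N) = ∑-δ N x x<N

∑-1 : ∀ n → ∑[ i < n ] 1 ≡ n
∑-1 zero    = refl
∑-1 (suc n) = cong suc (∑-1 n)

∑-𝟙-≤ : ∀ n (b : Fin n → Bool) → ∑[ i < n ] 𝟙 (b i) ≤ n
∑-𝟙-≤ zero    b = z≤n
∑-𝟙-≤ (suc n) b = +-mono-≤ (𝟙≤1 (b zero)) (∑-𝟙-≤ n (λ i → b (suc i)))
  where
  𝟙≤1 : ∀ c → 𝟙 c ≤ 1
  𝟙≤1 true  = ≤-refl
  𝟙≤1 false = z≤n

∑-fibres : ∀ m N (d : Fin m → ℕ) → (∀ i → d i < N) → ∑[ k < N ] ∑[ i < m ] δ (toℕ k) (d i) ≡ m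
∑-fibres m N d d<N = begin
  ∑[ k < N ] ∑[ i < m ] δ (toℕ k) (d i) ≡⟨ ∑-comm {N} {m} (λ k i → δ (toℕ k) (d i)) ⟩
  ∑[ i < m ] ∑[ k < N ] δ (toℕ k) (d i) ≡⟨ sum-cong-≗ (λ i → ∑-δ N (d i) (d<N i)) ⟩
  ∑[ i < m ] 1                          ≡⟨ ∑-1 m ⟩
  m                                     ∎

∑-δ-* : ∀ {m n} k (w : Fin m → Fin n → ℕ) →
  (∑[ i < m ] δ k (∑[ j < n ] w i j)) * k ≡ ∑[ i < m ] ∑[ j < n ] (δ k (∑[ j′ < n ] w i j′) * w i j)
∑-δ-* {m} {n} k w = begin
  (∑[ i < m ] δ k (row i)) * k    ≡⟨ *-distribʳ-sum k (λ i → δ k (row i)) ⟩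
  ∑[ i < m ] (δ k (row i) * k)     ≡⟨ sum-cong-≗ (λ i → δ-*-comm k (row i)) ⟨
  ∑[ i < m ] (δ k (row i) * row i) ≡⟨ sum-cong-≗ (λ i → *-distribˡ-sum (δ k (row i)) (w i)) ⟩
  ∑[ i < m ] ∑[ j < n ] (δ k (row i) * w i j) ∎
  where
  row : Fin m → ℕ
  row i = ∑[ j < n ] w i j

module _ {m n : ℕ} {R : Fin m → Fin n → Set} (R? : ∀ i j → Dec (R i j)) where

  degˡ : Fin m → ℕ
  degˡ i = ∑[ j < n ] 𝟙 ⌊ R? i j ⌋

  degʳ : Fin n → ℕ
  degʳ j = ∑[ i < m ] 𝟙 ⌊ R? i j ⌋

  -- The number of vertices of degree k on either side, times k, counts the edges at them.
  degree-regular-sides-equal :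
    (∀ i → 0 < degˡ i) → (∀ j → 0 < degʳ j) →
    (∀ i j → R i j → degˡ i ≡ degʳ j) → m ≡ n
  degree-regular-sides-equal degˡ>0 degʳ>0 edge = begin
    m                               ≡⟨ ∑-fibres m N degˡ (λ i → s≤s (≤-trans (∑-𝟙-≤ n _) (m≤n+m n m))) ⟨
    ∑[ k < N ] classˡ (toℕ k)       ≡⟨ sum-cong-≗ {N} (λ k → class-≡ (toℕ k)) ⟩
    ∑[ k < N ] classʳ (toℕ k)       ≡⟨ ∑-fibres n N degʳ (λ j → s≤s (≤-trans (∑-𝟙-≤ m _) (m≤m+n m n))) ⟩
    n                               ∎
    where
    N : ℕ
    N = suc (m + n)

    classˡ classʳ : ℕ → ℕ
    classˡ k = ∑[ i < m ] δ k (degˡ i)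
    classʳ k = ∑[ j < n ] δ k (degʳ j)

    edge-δ : ∀ k i j → δ k (degˡ i) * 𝟙 ⌊ R? i j ⌋ ≡ δ k (degʳ j) * 𝟙 ⌊ R? i j ⌋
    edge-δ k i j with R? i j
    ... | yes r = cong (λ d → δ k d * 1) (edge i j r)
    ... | no  _ = trans (*-zeroʳ (δ k (degˡ i))) (sym (*-zeroʳ (δ k (degʳ j))))

    class-* : ∀ k → classˡ k * k ≡ classʳ k * k
    class-* k = begin
      classˡ k * k ≡⟨ ∑-δ-* k (λ i j → 𝟙 ⌊ R? i j ⌋) ⟩
      ∑[ i < m ] ∑[ j < n ] (δ k (degˡ i) * 𝟙 ⌊ R? i j ⌋) ≡⟨ sum-cong-≗ (λ i → sum-cong-≗ (edge-δ k i)) ⟩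
      ∑[ i < m ] ∑[ j < n ] (δ k (degʳ j) * 𝟙 ⌊ R? i j ⌋) ≡⟨ ∑-comm {m} {n} _ ⟩
      ∑[ j < n ] ∑[ i < m ] (δ k (degʳ j) * 𝟙 ⌊ R? i j ⌋) ≡⟨ ∑-δ-* k (λ j i → 𝟙 ⌊ R? i j ⌋) ⟨
      classʳ k * k ∎

    δ0-positive : ∀ {d} → 0 < d → δ 0 d ≡ 0
    δ0-positive (s≤s _) = refl

    class-≡ : ∀ k → classˡ k ≡ classʳ k
    class-≡ zero    = trans (sum-cong-≗ (λ i → δ0-positive (degˡ>0 i))) (trans (sum-replicate-zero m)
                       (sym (trans (sum-cong-≗ (λ j → δ0-positive (degʳ>0 j))) (sum-replicate-zero n))))
    class-≡ (suc k) = *-cancelʳ-≡ (classˡ (suc k)) (classʳ (suc k)) (suc k) (class-* (suc k))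

length-filter-tabulate : ∀ {A : Set} {P : A → Set} (P? : Decidable P) {n} (f : Fin n → A) →
  length (filter P? (tabulate f)) ≡ ∑[ i < n ] 𝟙 ⌊ P? (f i) ⌋
length-filter-tabulate P? {zero}  f = refl
length-filter-tabulate P? {suc n} f with P? (f zero)
... | yes _ = cong suc (length-filter-tabulate P? (λ i → f (suc i)))
... | no  _ = length-filter-tabulate P? (λ i → f (suc i))

module _ {V : Set} where

  lookup-injective : ∀ {xs : List V} → Unique xs → ∀ {i j} → lookup xs i ≡ lookup xs j → i ≡ j
  lookup-injective {_ ∷ _}  (_  ∷ _)  {zero}  {zero}  _  = refl
  lookup-injective {_ ∷ xs} (x∉ ∷ _)  {zero}  {suc j} eq = ⊥-elim (All.lookup x∉ (∈-lookup j) eq)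
  lookup-injective {_ ∷ xs} (x∉ ∷ _)  {suc i} {zero}  eq = ⊥-elim (All.lookup x∉ (∈-lookup i) (sym eq))
  lookup-injective {_ ∷ _}  (_  ∷ u) {suc i} {suc j} eq = cong suc (lookup-injective u eq)

  ∈-unique-≡-dec : ∀ {zs : List V} {x y} → Unique zs → x ∈ zs → y ∈ zs → Dec (x ≡ y)
  ∈-unique-≡-dec (_  ∷ _) (here x≡)  (here y≡)  = yes (trans x≡ (sym y≡))
  ∈-unique-≡-dec (z∉ ∷ _) (here x≡)  (there y∈) = no (λ x≡y → All.lookup z∉ y∈ (trans (sym x≡) x≡y))
  ∈-unique-≡-dec (z∉ ∷ _) (there x∈) (here y≡)  = no (λ x≡y → All.lookup z∉ x∈ (trans (sym y≡) (sym x≡y)))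
  ∈-unique-≡-dec (_  ∷ u) (there x∈) (there y∈) = ∈-unique-≡-dec u x∈ y∈

  private variable
    P Q : V → Set
    n : ℕ

  ∈⇒lookup : ∀ {xs : List V} {x} → x ∈ xs → ∃ λ i → x ≡ lookup xs i
  ∈⇒lookup x∈ = index x∈ , lookup-index x∈

  HasCard-cong : (∀ x → P x ⇔ Q x) → HasCard P n → HasCard Q n
  HasCard-cong P⇔Q (xs , u , len , mem) =
    xs , u , len , λ x → mk⇔ (to (P⇔Q x) ∘ to (mem x)) (from (mem x) ∘ from (P⇔Q x))

  HasCard-preimage : (f g : V → V) → (∀ x → g (f x) ≡ x) → (∀ y → f (g y) ≡ y) →
    HasCard P n → HasCard (λ y → P (g y)) n
  HasCard-preimage {P} f g gf fg (xs , u , len , mem) =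
    map f xs , Unique.map⁺ f-injective u , trans (length-map f xs) len ,
    λ y → mk⇔ (to-P y) (λ Pgy → subst (_∈ map f xs) (fg y) (∈-map⁺ f (from (mem (g y)) Pgy)))
    where
    f-injective : ∀ {x x′} → f x ≡ f x′ → x ≡ x′
    f-injective {x} {x′} eq = trans (sym (gf x)) (trans (cong g eq) (gf x′))
    to-P : ∀ y → y ∈ map f xs → P (g y)
    to-P y y∈ with ∈-map⁻ f y∈
    ... | x , x∈ , refl = subst P (sym (gf x)) (to (mem x) x∈)

  HasCard⇒positive : ∀ {x} → HasCard P n → P x → 0 < n
  HasCard⇒positive {x = x} (xs , _ , refl , mem) Px with from (mem x) Px
  ... | here  _ = s≤s z≤n
  ... | there _ = s≤s z≤n

  HasCard-filter : ∀ {n} (b : Fin n → V) → (∀ {i j} → b i ≡ b j → i ≡ j) →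
    (∀ y → P y → ∃ λ j → y ≡ b j) → (P? : ∀ j → Dec (P (b j))) →
    HasCard P (∑[ j < n ] 𝟙 ⌊ P? j ⌋)
  HasCard-filter {P} {n} b b-injective covers P? =
    map b selected ,
    Unique.map⁺ b-injective (Unique.filter⁺ P? (Unique.allFin⁺ n)) ,
    trans (length-map b selected) (length-filter-tabulate P? (λ j → j)) ,
    λ y → mk⇔ (to-P y) (from-P y)
    where
    selected : List (Fin n)
    selected = filter P? (allFin n)
    to-P : ∀ y → y ∈ map b selected → P y
    to-P y y∈ with ∈-map⁻ b y∈
    ... | j , j∈ , refl with ∈-filter⁻ P? {xs = allFin n} j∈
    ... | _ , Pbj = Pbj
    from-P : ∀ y → P y → y ∈ map b selected
    from-P y Py with covers y Py
    ... | j , refl = ∈-map⁺ b (∈-filter⁺ P? {xs = allFin n} (∈-allFin j) Py)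

  HasCard-singleton : (∀ {x y} → P x → P y → x ≡ y) → ∃ P → HasCard P 1
  HasCard-singleton P-unique (x , Px) =
    x ∷ [] , All.[] ∷ [] , refl , λ y → mk⇔ (λ { (here refl) → Px }) (λ Py → here (P-unique Py Px))

  HasCard-subsingleton : (∀ {x y} → P x → P y → x ≡ y) → HasCard P n →
    (n ≡ 0 × ¬ ∃ P) ⊎ (n ≡ 1 × ∃ P)
  HasCard-subsingleton _ ([] , _ , refl , mem) = inj₁ (refl , λ (x , Px) → case from (mem x) Px of λ ())
  HasCard-subsingleton _ (x ∷ [] , _ , refl , mem) = inj₂ (refl , x , to (mem x) (here refl))
  HasCard-subsingleton P-unique (x ∷ y ∷ _ , (x∉ ∷ _) , refl , mem) =
    ⊥-elim (All.head x∉ (P-unique (to (mem x) (here refl)) (to (mem y) (there (here refl)))))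

  HasCard-empty : (∀ x → ¬ P x) → HasCard P 0
  HasCard-empty ¬P = [] , [] , refl , λ x → mk⇔ (λ ()) (⊥-elim ∘ ¬P x)

  SameCard-subsingletons : (∀ {x y} → P x → P y → x ≡ y) → (∀ {x y} → Q x → Q y → x ≡ y) →
    (∃ P → ∃ Q) → (∃ Q → ∃ P) → SameCard P Q
  SameCard-subsingletons P-unique Q-unique P⇒Q Q⇒P m n Pm Qn
    with HasCard-subsingleton P-unique Pm | HasCard-subsingleton Q-unique Qn
  ... | inj₁ (refl , _)  | inj₁ (refl , _)  = refl
  ... | inj₂ (refl , _)  | inj₂ (refl , _)  = refl
  ... | inj₁ (_ , ¬∃P)   | inj₂ (_ , ∃Q)    = ⊥-elim (¬∃P (Q⇒P ∃Q))
  ... | inj₂ (_ , ∃P)    | inj₁ (_ , ¬∃Q)   = ⊥-elim (¬∃Q (P⇒Q ∃P))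

¬¬-Π-Fin : ∀ {n} {P : Fin n → Set} → (∀ i → ¬ ¬ P i) → ¬ ¬ (∀ i → P i)
¬¬-Π-Fin {zero}      _   ¬∀ = ¬∀ (λ ())
¬¬-Π-Fin {suc n} {P} ¬¬P ¬∀ = ¬¬P zero λ P₀ → ¬¬-Π-Fin (¬¬P ∘ suc) λ P₊ → ¬∀ (cons P₀ P₊)
  where
  cons : P zero → (∀ i → P (suc i)) → ∀ i → P i
  cons P₀ P₊ zero    = P₀
  cons P₀ P₊ (suc i) = P₊ i

module _ {V : Set} {E : V → V → Set} where

  _∘ᴬ_ : Aut E → Aut E → Aut E
  α ∘ᴬ β = record
    { fun   = fun α ∘ fun β
    ; inv   = inv β ∘ inv α
    ; inv-l = λ x → trans (cong (inv β) (inv-l α (fun β x))) (inv-l β x)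
    ; inv-r = λ x → trans (cong (fun α) (inv-r β (inv α x))) (inv-r α x)
    ; pres  = λ x y → mk⇔ (to (pres α _ _) ∘ to (pres β x y)) (from (pres β x y) ∘ from (pres α _ _))
    }

  _⁻¹ᴬ : Aut E → Aut E
  α ⁻¹ᴬ = record
    { fun   = inv α
    ; inv   = fun α
    ; inv-l = inv-r α
    ; inv-r = inv-l α
    ; pres  = λ x y → mk⇔
        (λ e → from (pres α (inv α x) (inv α y)) (subst₂ E (sym (inv-r α x)) (sym (inv-r α y)) e))
        (λ e → subst₂ E (inv-r α x) (inv-r α y) (to (pres α (inv α x) (inv α y)) e))
    }

  fun≡⇒inv≡ : ∀ (α : Aut E) {x y} → fun α x ≡ y → inv α y ≡ x
  fun≡⇒inv≡ α {x} refl = inv-l α x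

  -- InStabOrb S u x y is definitionally Carries S u x u y.
  Carries : (Aut E → Set) → V → V → V → V → Set
  Carries S u x u′ x′ = Σ (Aut E) λ β → S β × fun β u ≡ u′ × fun β x ≡ x′

  Carries-swap : ∀ {S u x u′ x′} → Carries S u x u′ x′ → Carries S x u x′ u′
  Carries-swap (β , Sβ , βu , βx) = β , Sβ , βx , βu

  Carries⇒InOrbit : ∀ {S u x u′ x′} → Carries S u x u′ x′ → InOrbit S u u′
  Carries⇒InOrbit (β , Sβ , βu , _) = β , Sβ , βu

  Carries-edge : ∀ {S u x u′ x′} → Carries S u x u′ x′ → E u x → E u′ x′
  Carries-edge (β , _ , refl , refl) = to (pres β _ _)

  module _ {S : Aut E → Set} (S-subgroup : IsSubgroup S) where

    open IsSubgroup S-subgroup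

    ∘ᴬ-closed : ∀ {α β} → S α → S β → S (α ∘ᴬ β)
    ∘ᴬ-closed {α} {β} = comp α β (α ∘ᴬ β) (λ _ → refl)

    ⁻¹ᴬ-closed : ∀ {α} → S α → S (α ⁻¹ᴬ)
    ⁻¹ᴬ-closed {α} = inverse α (α ⁻¹ᴬ) (λ _ → refl)

    InOrbit-sym : ∀ {u x} → InOrbit S u x → InOrbit S x u
    InOrbit-sym (α , Sα , αu) = α ⁻¹ᴬ , ⁻¹ᴬ-closed Sα , fun≡⇒inv≡ α αu

    InOrbit-trans : ∀ {u x y} → InOrbit S u x → InOrbit S x y → InOrbit S u y
    InOrbit-trans (α , Sα , refl) (β , Sβ , refl) = β ∘ᴬ α , ∘ᴬ-closed Sβ Sα , refl

    InOrbit⇒SameOrbit : ∀ {u x} → InOrbit S u x → SameOrbit S x u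
    InOrbit⇒SameOrbit u→x y = mk⇔ (InOrbit-trans u→x) (InOrbit-trans (InOrbit-sym u→x))

    Carries-sym : ∀ {u x u′ x′} → Carries S u x u′ x′ → Carries S u′ x′ u x
    Carries-sym (β , Sβ , βu , βx) = β ⁻¹ᴬ , ⁻¹ᴬ-closed Sβ , fun≡⇒inv≡ β βu , fun≡⇒inv≡ β βx

    Carries-trans : ∀ {u x u′ x′ u″ x″} → Carries S u x u′ x′ → Carries S u′ x′ u″ x″ → Carries S u x u″ x″
    Carries-trans (α , Sα , refl , refl) (β , Sβ , refl , refl) = β ∘ᴬ α , ∘ᴬ-closed Sβ Sα , refl , refl

    -- Conjugation by the automorphism β carrying (v, x₀) to (y₀, w) identifies Stab_v x₀ with Stab_{y₀} w.
    Unimodular⇒carried-cards-equal : Unimodular S → ∀ {v w x₀ y₀ p q} → Carries S v x₀ y₀ w →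
      HasCard (λ y → Carries S v x₀ y w) p → HasCard (λ x → Carries S v x y₀ w) q → p ≡ q
    Unimodular⇒carried-cards-equal U {v} {w} {x₀} {y₀} {p} {q} c@(β , Sβ , βv , _) row col =
      U w y₀ p q (HasCard-cong row⇔ row)
        (HasCard-cong conj⇔ (HasCard-preimage (fun β) (inv β) (inv-l β) (inv-r β) (HasCard-cong col⇔ col)))
      where
      row⇔ : ∀ y → Carries S v x₀ y w ⇔ InStabOrb S w y₀ y
      row⇔ y = mk⇔ (Carries-swap ∘ Carries-trans (Carries-sym c)) (Carries-trans c ∘ Carries-swap)

      col⇔ : ∀ x → Carries S v x y₀ w ⇔ InStabOrb S v x₀ x
      col⇔ x = mk⇔ (Carries-trans c ∘ Carries-sym) (λ e → Carries-trans (Carries-sym e) c)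

      β-carries : ∀ z → Carries S v (inv β z) y₀ z
      β-carries z = β , Sβ , βv , inv-r β z

      conj⇔ : ∀ z → InStabOrb S v x₀ (inv β z) ⇔ InStabOrb S y₀ w z
      conj⇔ z = mk⇔ (λ e → Carries-trans (Carries-sym c) (Carries-trans e (β-carries z)))
                    (λ e → Carries-trans (Carries-trans c e) (Carries-sym (β-carries z)))

    NbrIn⇒carried : ∀ {v w x} → NbrIn S v w x → ∃ λ y → Carries S v x y w
    NbrIn⇒carried {v} (_ , α , Sα , αw) = inv α v , α ⁻¹ᴬ , ⁻¹ᴬ-closed Sα , refl , fun≡⇒inv≡ α αw

    NbrIn⇒carrier : ∀ {v w y} → NbrIn S w v y → ∃ λ x → Carries S v x y w
    NbrIn⇒carrier {w = w} (_ , α , Sα , αv) = inv α w , α , Sα , αv , inv-r α w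

    module _ (E-sym : ∀ x y → E x y → E y x) where

      Carries⇒NbrInʳ : ∀ {v w x y} → E v x → Carries S v x y w → NbrIn S w v y
      Carries⇒NbrInʳ vx c = E-sym _ _ (Carries-edge c vx) , Carries⇒InOrbit c

      Carries⇒NbrInˡ : ∀ {v w x y} → E w y → Carries S v x y w → NbrIn S v w x
      Carries⇒NbrInˡ wy c =
        Carries-edge (Carries-sym c) (E-sym _ _ wy) , Carries⇒InOrbit (Carries-swap (Carries-sym c))

      NbrIn-swap : ∀ {v w} → ∃ (NbrIn S v w) → ∃ (NbrIn S w v)
      NbrIn-swap (x , x∈) with NbrIn⇒carried x∈
      ... | y , c = y , Carries⇒NbrInʳ (proj₁ x∈) c

      Unimodular⇒Symmetric : Unimodular S → Symmetric S
      Unimodular⇒Symmetric U v w _ _ (xs , xs-unique , refl , xs-mem) (ys , ys-unique , refl , ys-mem) =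
        decidable-stable (length xs ≟ length ys)
          (¬¬-map sides-equal (¬¬-Π-Fin λ i → ¬¬-Π-Fin λ j → ¬¬-excluded-middle))
        where
        Joined : Fin (length xs) → Fin (length ys) → Set
        Joined i j = Carries S v (lookup xs i) (lookup ys j) w

        sides-equal : (∀ i j → Dec (Joined i j)) → length xs ≡ length ys
        sides-equal J? = degree-regular-sides-equal J? degˡ>0 degʳ>0
          (λ i j c → Unimodular⇒carried-cards-equal U c (degˡ-card i) (degʳ-card j))
          where
          xᵢ∈X : ∀ i → NbrIn S v w (lookup xs i)
          xᵢ∈X i = to (xs-mem _) (∈-lookup i)

          yⱼ∈Y : ∀ j → NbrIn S w v (lookup ys j)
          yⱼ∈Y j = to (ys-mem _) (∈-lookup j)

          degˡ-card : ∀ i → HasCard (λ y → Carries S v (lookup xs i) y w) (degˡ J? i)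
          degˡ-card i = HasCard-filter (lookup ys) (lookup-injective ys-unique)
            (λ y c → ∈⇒lookup (from (ys-mem y) (Carries⇒NbrInʳ (proj₁ (xᵢ∈X i)) c))) (J? i)

          degʳ-card : ∀ j → HasCard (λ x → Carries S v x (lookup ys j) w) (degʳ J? j)
          degʳ-card j = HasCard-filter (lookup xs) (lookup-injective xs-unique)
            (λ x c → ∈⇒lookup (from (xs-mem x) (Carries⇒NbrInˡ (proj₁ (yⱼ∈Y j)) c))) (λ i → J? i j)

          degˡ>0 : ∀ i → 0 < degˡ J? i
          degˡ>0 i = HasCard⇒positive (degˡ-card i) (proj₂ (NbrIn⇒carried (xᵢ∈X i)))

          degʳ>0 : ∀ j → 0 < degʳ J? j
          degʳ>0 j = HasCard⇒positive (degʳ-card j) (proj₂ (NbrIn⇒carrier (yⱼ∈Y j)))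

      -- Type 3 only refutes x ≢ y; local finiteness makes equality of neighbours decidable.
      Type3⇒NbrIn-unique : LocallyFinite E → Type3 S →
        ∀ {v w x y} → NbrIn S v w x → NbrIn S v w y → x ≡ y
      Type3⇒NbrIn-unique LF T {v} {x = x} {y} (vx , w→x) (vy , w→y) with LF v
      ... | _ , zs , zs-unique , _ , zs-mem =
        decidable-stable (∈-unique-≡-dec zs-unique (from (zs-mem x) vx) (from (zs-mem y) vy))
          λ x≢y → T x y (x≢y ∘ sym) (InOrbit⇒SameOrbit (InOrbit-trans (InOrbit-sym w→x) w→y))
                    2 (s≤s (s≤s (s≤s z≤n))) (step (E-sym v x vx) (step vy here))

    Type3⇒NbrIn-self-empty : (∀ x → ¬ E x x) → Type3 S → ∀ v x → ¬ NbrIn S v v x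
    Type3⇒NbrIn-self-empty irrefl T v x (vx , v→x) =
      T v x (λ { refl → irrefl v vx }) (InOrbit⇒SameOrbit v→x) 1 (s≤s (s≤s z≤n)) (step vx here)

lemma3p7 : {V : Set} (E : V → V → Set) →
    IsSimple E → InfiniteType V → Connected E → LocallyFinite E →
    (A A0 : Aut E → Set) → IsSubgroup A → IsSubgroup A0 →
    Subset A0 A → IsNormalIn A0 A → Transitive A →
    (Unimodular A0 → Symmetric A0) ×
    (Type3 A0 →
      (∀ v → HasCard (NbrIn A0 v v) 0) ×
      (∀ v w → ¬ SameOrbit A0 v w → (∃ λ x → NbrIn A0 v w x) →
        HasCard (NbrIn A0 v w) 1 × HasCard (NbrIn A0 w v) 1) ×
      Symmetric A0)
lemma3p7 E (E-sym , irrefl) _ _ LF _ A0 _ A0-subgroup _ _ _ =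
  Unimodular⇒Symmetric A0-subgroup E-sym ,
  λ T → let unique = Type3⇒NbrIn-unique A0-subgroup E-sym LF T
            swap   = NbrIn-swap A0-subgroup E-sym
        in (λ v → HasCard-empty (Type3⇒NbrIn-self-empty A0-subgroup irrefl T v)) ,
           (λ v w _ ∃x → HasCard-singleton unique ∃x , HasCard-singleton unique (swap ∃x)) ,
           (λ v w → SameCard-subsingletons unique unique swap swap)
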